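{- Let $\Delta$ be a visibly pushdown automaton (vPDA) over actions $\mathit{Act}=\mathit{Act}_c\cup\mathit{Act}_r\cup\mathit{Act}_i$, stack alphabet $\Gamma$ and control states $Q$, and let $pX$ and $qY$ be two of its processes ($p,q\in Q$, $X,Y\in\Gamma$). Let $\Delta'$ be the pushdown automaton constructed from $\Delta$ as described in the context, and consider its configuration $(p,q)(X,Y)$. Define the modal $\mu$-calculus formulae \begin{itemize} \item $\phi_{\sqsubseteq_s} \equiv \nu Z.[\ell]\langle r\rangle Z$, \item $\phi_{=_s} \equiv \phi_{\sqsubseteq_s} \wedge (\nu Z.[r]\langle \ell\rangle Z)$, \item $\phi_{\sqsubseteq_{cs}} \equiv \nu Z.\big([\ell]\langle r\rangle Z \wedge (\langle \mathit{Act}\rangle tt \Leftrightarrow \langle \overline{\mathit{Act}}\rangle tt)\big)$, \item $\phi_{=_{cs}} \equiv \phi_{\sqsubseteq_{cs}} \wedge \nu Z.\big([r]\langle \ell\rangle Z \wedge (\langle \mathit{Act}\rangle tt \Leftrightarrow \langle \overline{\mathit{Act}}\rangle tt)\big)$, \item $\phi_{\sqsubseteq_{rs}} \equiv \nu Z.\big([\ell]\langle r\rangle Z \wedge \bigwedge_{a\in\mathit{Act}} (\langle a\rangle tt \Leftrightarrow \langle \overline{a}\rangle tt)\big)$, \item $\phi_{=_{rs}} \equiv \phi_{\sqsubseteq_{rs}} \wedge \nu Z.\big([r]\langle \ell\rangle Z \wedge \bigwedge_{a\in\mathit{Act}} (\langle a\rangle tt \Leftrightarrow \langle \overline{a}\rangle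 tt)\big)$, \item $\phi_{\sqsubseteq_{2s}} \equiv \nu Z.\big([\ell]\langle r\rangle Z \wedge (\nu Z'.[r]\langle \ell\rangle Z')\big)$, \item $\phi_{=_{2s}} \equiv \phi_{\sqsubseteq_{2s}} \wedge \nu Z.\big([r]\langle \ell\rangle Z \wedge (\nu Z'.[\ell]\langle r\rangle Z')\big)$, \item $\phi_{\sim} \equiv \nu Z.[\ell,r]\langle \ell,r\rangle Z$. \end{itemize} Then for every $\bowtie\ \in \{\sqsubseteq_s,=_s,\sqsubseteq_{cs},=_{cs},\sqsubseteq_{rs},=_{rs},\sqsubseteq_{2s},=_{2s},\sim\}$ it holds that $pX \bowtie qY$ (in the transition system of $\Delta$) if and only if $(p,q)(X,Y) \models \phi_{\bowtie}$ (in the transition system of $\Delta'$).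
   Context: A labelled transition system (LTS) is $(S,\mathit{Act},\to)$ with $\to\subseteq S\times\mathit{Act}\times S$; write $s\xrightarrow{a}s'$. $I(s)=\{a\mid \exists s'.\,s\xrightarrow{a}s'\}$. A relation $R\subseteq S\times S$ is a simulation if for all $(s,t)\in R$ and $s\xrightarrow{a}s'$ there is $t\xrightarrow{a}t'$ with $(s',t')\in R$; a completed simulation if it is a simulation and for all $(s,t)\in R$, $I(s)=\emptyset$ iff $I(t)=\emptyset$; a ready simulation if it is a simulation and $I(s)=I(t)$ for all $(s,t)\in R$; a 2-nested simulation if it is a simulation and $R^{ -1}\subseteq R'$ for some simulation $R'$; a bisimulation if it is a simulation and $R^{ -1}=R$. $s\sqsubseteq_s t$ ($\sqsubseteq_{cs}$, $\sqsubseteq_{rs}$, $\sqsubseteq_{2s}$, $\sim$) iff some simulation (completed, ready, 2-nested simulation, bisimulation) contains $(s,t)$. For each preorder $\sqsubseteq$ among these, $s=t$ iff $s\sqsubseteq t$ and $t\sqsubseteq s$ (giving $=_s,=_{cs},=_{rs},=_{2s}$). A pushdown automaton (PDA) over a finite action set $\mathit{Act}$, stack alphabet $\Gamma$ and control states $Q$ is a finite set $\Delta$ of rules $pX\xrightarrow{a}q\alpha$ with $p,q\in Q$, $a\in\mathit{Act}$, $X\in\Gamma$, $\alpha\in\Gamma^*$. It generates the LTS with states $Q\times\Gamma^*$ (written $p\alpha$, top of stack leftmost) and transitions $pX\gamma\xrightarrow{a}q\alpha\gamma$ for each rule $pX\xrightarrow{a}q\alpha$ and $\gamma\in\Gamma^*$.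 A vPDA is a PDA where $\mathit{Act}$ is partitioned into call, return and internal actions $\mathit{Act}_c,\mathit{Act}_r,\mathit{Act}_i$, and every rule $pX\xrightarrow{a}q\alpha$ satisfies $|\alpha|=2$ if $a\in\mathit{Act}_c$, $|\alpha|=0$ if $a\in\mathit{Act}_r$, $|\alpha|=1$ if $a\in\mathit{Act}_i$. A process $pX$ is a configuration with a single stack symbol. Construction of $\Delta'$: it is a PDA over actions $\mathit{Act}'=\mathit{Act}\cup\overline{\mathit{Act}}\cup\{\ell,r\}$ with $\overline{\mathit{Act}}=\{\overline{a}\mid a\in\mathit{Act}\}$ (fresh), control states $Q\times Q$, and stack alphabet $G\times G$ where $G=\Gamma\cup(\Gamma\times\Gamma)\cup(\Gamma\times\mathit{Act})\cup\{\epsilon\}$; the element $(X,a)\in\Gamma\times\mathit{Act}$ is written $X_a$, and a word $\alpha\in\Gamma^*$ with $|\alpha|\le 2$ is identified with the corresponding element of $\Gamma\cup(\Gamma\times\Gamma)\cup\{\epsilon\}$. The partial merge map $[\cdot,\cdot]:\Gamma^*\times\Gamma^*\to(\Gamma\times\Gamma)^*$ is defined for words of equal length by $[X\alpha,Y\beta]=(X,Y)[\alpha,\beta]$ and $[\epsilon,\epsilon]=\epsilon$. For every rule $(pX\xrightarrow{a}q\alpha)\in\Delta$, $\Delta'$ contains: (1) $(p,p')(X,X')\xrightarrow{\ell}(q,p')(\alpha,X'_a)$ for all $p'\in Q$, $X'\in\Gamma$; (2) $(p',p)(X',X)\xrightarrow{r}(p',q)(X'_a,\alpha)$ for all $p'\in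 Q$, $X'\in\Gamma$; (3) $(p',p)(\beta,X_a)\xrightarrow{r}(p',q)[\beta,\alpha]$ for all $p'\in Q$ and $\beta\in\Gamma\cup(\Gamma\times\Gamma)\cup\{\epsilon\}$ (whenever $[\beta,\alpha]$ is defined); (4) $(p,p')(X_a,\beta)\xrightarrow{\ell}(q,p')[\alpha,\beta]$ for all $p'\in Q$ and such $\beta$ (whenever defined); (5) $(p,p')(X,X')\xrightarrow{a}(p,p')(X,X')$ for all $p'\in Q$, $X'\in\Gamma$; (6) $(p',p)(X',X)\xrightarrow{\overline{a}}(p',p)(X',X)$ for all $p'\in Q$, $X'\in\Gamma$. Modal $\mu$-calculus: $\langle A\rangle\phi$ holds if some transition labelled by an action in $A$ leads to a state satisfying $\phi$; $[A]\phi$ holds if all such transitions do; $tt$ is true; $\nu$ is the greatest fixed point. -}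

module Defs where

open import Level using (Level; _⊔_) renaming (suc to lsuc; zero to lzero)
open import Data.Nat using (ℕ)
open import Data.Fin using (Fin)
open import Data.List using (List; []; _∷_; _++_; length)
open import Data.List.Membership.Propositional using (_∈_)
open import Data.List.Relation.Unary.All using (All)
open import Data.Maybe using (Maybe; just; nothing)
open import Data.Product using (Σ; _×_; _,_)
open import Data.Sum using (_⊎_)
open import Data.Unit using (⊤)
open import Relation.Nullary using (¬_)
open import Relation.Binary.PropositionalEquality using (_≡_)

record LTS : Set₁ where
  field
    St    : Set
    Ac    : Set
    _⟶⟨_⟩_ : St → Ac → St → Set

module LTSNotions (L : LTS) where
  open LTS L

  Rel : Set₁
  Rel = St → St → Set

  _∈I_ : Ac → St → Set
  a ∈I s = Σ St λ s' → s ⟶⟨ a ⟩ s'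

  I-empty : St → Set
  I-empty s = ∀ a → ¬ (a ∈I s)

  IsSim : Rel → Set
  IsSim R = ∀ s t → R s t → ∀ a s' → s ⟶⟨ a ⟩ s' →
            Σ St λ t' → (t ⟶⟨ a ⟩ t') × R s' t'

  IsCompletedSim : Rel → Set
  IsCompletedSim R = IsSim R ×
    (∀ s t → R s t → (I-empty s → I-empty t) × (I-empty t → I-empty s))

  IsReadySim : Rel → Set
  IsReadySim R = IsSim R ×
    (∀ s t → R s t → ∀ a → (a ∈I s → a ∈I t) × (a ∈I t → a ∈I s))

  Is2NestedSim : Rel → Set₁
  Is2NestedSim R = IsSim R ×
    Σ Rel λ R' → IsSim R' × (∀ s t → R t s → R' s t)

  IsBisim : Rel → Set
  IsBisim R = IsSim R ×
    ((∀ s t → R t s → R s t) × (∀ s t → R s t → R t s))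

  _⊑s_ _⊑cs_ _⊑rs_ _⊑2s_ _∼_ : St → St → Set₁
  s ⊑s t  = Σ Rel λ R → IsSim R × R s t
  s ⊑cs t = Σ Rel λ R → IsCompletedSim R × R s t
  s ⊑rs t = Σ Rel λ R → IsReadySim R × R s t
  s ⊑2s t = Σ Rel λ R → Is2NestedSim R × R s t
  s ∼ t   = Σ Rel λ R → IsBisim R × R s t

  _=s_ _=cs_ _=rs_ _=2s_ : St → St → Set₁
  s =s t  = (s ⊑s t) × (t ⊑s s)
  s =cs t = (s ⊑cs t) × (t ⊑cs s)
  s =rs t = (s ⊑rs t) × (t ⊑rs s)
  s =2s t = (s ⊑2s t) × (t ⊑2s s)

  Pred : (ℓ : Level) → Set (lsuc ℓ)
  Pred ℓ = St → Set ℓ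

  ⟨_⟩_ : ∀ {ℓ} → (Ac → Set) → Pred ℓ → Pred ℓ
  (⟨ A ⟩ φ) s = Σ Ac λ a → A a × Σ St λ s' → (s ⟶⟨ a ⟩ s') × φ s'

  [_]_ : ∀ {ℓ} → (Ac → Set) → Pred ℓ → Pred ℓ
  ([ A ] φ) s = ∀ a s' → A a → s ⟶⟨ a ⟩ s' → φ s'

  tt : Pred lzero
  tt _ = ⊤

  _∧_ : ∀ {ℓ ℓ'} → Pred ℓ → Pred ℓ' → Pred (ℓ ⊔ ℓ')
  (φ ∧ ψ) s = φ s × ψ s

  _⇔_ : ∀ {ℓ ℓ'} → Pred ℓ → Pred ℓ' → Pred (ℓ ⊔ ℓ')
  (φ ⇔ ψ) s = (φ s → ψ s) × (ψ s → φ s)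

  -- νZ.F(Z): union of all post-fixed points (Knaster–Tarski)
  ν : ∀ {ℓ} → (Pred lzero → Pred ℓ) → Pred (lsuc lzero ⊔ ℓ)
  ν F s = Σ (Pred lzero) λ S → (∀ x → S x → F S x) × S s

module PDALTS {Q Γ A : Set} (Rl : Q → Γ → A → Q → List Γ → Set) where
  data Step : Q × List Γ → A → Q × List Γ → Set where
    step : ∀ {p X a q α γ} → Rl p X a q α → Step (p , X ∷ γ) a (q , α ++ γ)

  lts : LTS
  lts = record { St = Q × List Γ ; Ac = A ; _⟶⟨_⟩_ = Step }

record Rule (nQ nΓ nA : ℕ) : Set where
  constructor rule
  field
    src  : Fin nQ
    top  : Fin nΓ
    lab  : Fin nA
    tgt  : Fin nQ
    push : List (Fin nΓ)

PDA : ℕ → ℕ → ℕ → Set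
PDA nQ nΓ nA = List (Rule nQ nΓ nA)

RuleOf : ∀ {nQ nΓ nA} → PDA nQ nΓ nA →
         Fin nQ → Fin nΓ → Fin nA → Fin nQ → List (Fin nΓ) → Set
RuleOf Δ p X a q α = rule p X a q α ∈ Δ

LTSof : ∀ {nQ nΓ nA} → PDA nQ nΓ nA → LTS
LTSof Δ = PDALTS.lts (RuleOf Δ)

data Kind : Set where
  call ret int : Kind

arity : Kind → ℕ
arity call = 2
arity ret  = 0
arity int  = 1

-- kind gives the partition Act = Act_c ∪ Act_r ∪ Act_i
IsVPDA : ∀ {nQ nΓ nA} → (Fin nA → Kind) → PDA nQ nΓ nA → Set
IsVPDA kind Δ = All (λ r → length (Rule.push r) ≡ arity (kind (Rule.lab r))) Δ

data G (nΓ nA : ℕ) : Set where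
  sym  : Fin nΓ → G nΓ nA
  pair : Fin nΓ → Fin nΓ → G nΓ nA
  tag  : Fin nΓ → Fin nA → G nΓ nA
  eps  : G nΓ nA

wordG : ∀ {nΓ nA} → List (Fin nΓ) → Maybe (G nΓ nA)
wordG []              = just eps
wordG (X ∷ [])        = just (sym X)
wordG (X ∷ Y ∷ [])    = just (pair X Y)
wordG (_ ∷ _ ∷ _ ∷ _) = nothing

merge : ∀ {nΓ nA} → List (Fin nΓ) → List (Fin nΓ) → Maybe (List (G nΓ nA × G nΓ nA))
merge [] [] = just []
merge (X ∷ α) (Y ∷ β) with merge α β
... | just m  = just ((sym X , sym Y) ∷ m)
... | nothing = nothing
merge [] (_ ∷ _) = nothing
merge (_ ∷ _) [] = nothing

data Act' (nA : ℕ) : Set where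
  act : Fin nA → Act' nA
  bar : Fin nA → Act' nA
  L   : Act' nA
  R   : Act' nA

data Rule' {nQ nΓ nA : ℕ} (Δ : PDA nQ nΓ nA) :
     Fin nQ × Fin nQ → G nΓ nA × G nΓ nA → Act' nA → Fin nQ × Fin nQ →
     List (G nΓ nA × G nΓ nA) → Set where
  r1 : ∀ {p X a q α} p' X' {g} → RuleOf Δ p X a q α → wordG α ≡ just g →
       Rule' Δ (p , p') (sym X , sym X') L (q , p') ((g , tag X' a) ∷ [])
  r2 : ∀ {p X a q α} p' X' {g} → RuleOf Δ p X a q α → wordG α ≡ just g →
       Rule' Δ (p' , p) (sym X' , sym X) R (p' , q) ((tag X' a , g) ∷ [])
  r3 : ∀ {p X a q α} p' (β : List (Fin nΓ)) {gβ m} → RuleOf Δ p X a q α →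
       wordG β ≡ just gβ → merge β α ≡ just m →
       Rule' Δ (p' , p) (gβ , tag X a) R (p' , q) m
  r4 : ∀ {p X a q α} p' (β : List (Fin nΓ)) {gβ m} → RuleOf Δ p X a q α →
       wordG β ≡ just gβ → merge α β ≡ just m →
       Rule' Δ (p , p') (tag X a , gβ) L (q , p') m
  r5 : ∀ {p X a q α} p' X' → RuleOf Δ p X a q α →
       Rule' Δ (p , p') (sym X , sym X') (act a) (p , p') ((sym X , sym X') ∷ [])
  r6 : ∀ {p X a q α} p' X' → RuleOf Δ p X a q α →
       Rule' Δ (p' , p) (sym X' , sym X) (bar a) (p' , p) ((sym X' , sym X) ∷ [])

LTS' : ∀ {nQ nΓ nA} → PDA nQ nΓ nA → LTS
LTS' Δ = PDALTS.lts (Rule' Δ)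

module Formulae {nQ nΓ nA : ℕ} (Δ : PDA nQ nΓ nA) where
  open LTSNotions (LTS' Δ) public

  ℓs rs ℓr Acts Bars : Act' nA → Set
  ℓs b = b ≡ L
  rs b = b ≡ R
  ℓr b = (b ≡ L) ⊎ (b ≡ R)
  Acts b = Σ (Fin nA) λ a → b ≡ act a
  Bars b = Σ (Fin nA) λ a → b ≡ bar a

  single : Act' nA → Act' nA → Set
  single a b = b ≡ a

  φ⊑s φ=s φ⊑cs φ=cs φ⊑rs φ=rs φ⊑2s φ=2s φ∼ : Pred (lsuc lzero)
  φ⊑s  = ν λ Z → [ ℓs ] (⟨ rs ⟩ Z)
  φ=s  = φ⊑s ∧ ν (λ Z → [ rs ] (⟨ ℓs ⟩ Z))
  φ⊑cs = ν λ Z → ([ ℓs ] (⟨ rs ⟩ Z)) ∧ ((⟨ Acts ⟩ tt) ⇔ (⟨ Bars ⟩ tt))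
  φ=cs = φ⊑cs ∧ ν (λ Z → ([ rs ] (⟨ ℓs ⟩ Z)) ∧ ((⟨ Acts ⟩ tt) ⇔ (⟨ Bars ⟩ tt)))
  φ⊑rs = ν λ Z → ([ ℓs ] (⟨ rs ⟩ Z)) ∧
           (λ s → ∀ a → ((⟨ single (act a) ⟩ tt) ⇔ (⟨ single (bar a) ⟩ tt)) s)
  φ=rs = φ⊑rs ∧ ν (λ Z → ([ rs ] (⟨ ℓs ⟩ Z)) ∧
           (λ s → ∀ a → ((⟨ single (act a) ⟩ tt) ⇔ (⟨ single (bar a) ⟩ tt)) s))
  φ⊑2s = ν λ Z → ([ ℓs ] (⟨ rs ⟩ Z)) ∧ ν (λ Z' → [ rs ] (⟨ ℓs ⟩ Z'))
  φ=2s = φ⊑2s ∧ ν (λ Z → ([ rs ] (⟨ ℓs ⟩ Z)) ∧ ν (λ Z' → [ ℓs ] (⟨ rs ⟩ Z')))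
  φ∼   = ν λ Z → [ ℓr ] (⟨ ℓr ⟩ Z)

conf' : ∀ {nQ nΓ nA} → Fin nQ → Fin nQ → Fin nΓ → Fin nΓ →
        (Fin nQ × Fin nQ) × List (G nΓ nA × G nΓ nA)
conf' p q X Y = (p , q) , ((sym X , sym Y) ∷ [])

infix 3 _iff_
_iff_ : ∀ {a b} → Set a → Set b → Set (a ⊔ b)
A iff B = (A → B) × (B → A)

proc : ∀ {nQ nΓ} → Fin nQ → Fin nΓ → Fin nQ × List (Fin nΓ)
proc p X = p , (X ∷ [])

-- Δ' runs two copies of Δ side by side on a stack of pairs, so two configurations s, t of Δ with
-- stacks of equal height are encoded by the single configuration s ⊗ t of Δ'. An ℓ-move lets the
-- left copy apply a rule labelled a and records a on the right component; from there the only moves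
-- are r-moves in which the right copy applies a rule with the same label. Hence [ℓ]⟨r⟩Z holds at
-- s ⊗ t iff every a-move of s is answered by an a-move of t into Z, and dually for [r]⟨ℓ⟩. Visibility
-- makes this work: rules with equal labels push words of equal length, so the stacks stay aligned and
-- the answer lands again in an encoded pair s' ⊗ t'. Post-fixed points of these modalities are thus
-- simulations, and the extra conjuncts of the formulae express the local side conditions: the loops
-- a and ā (rules 5 and 6) expose the initial actions of either side, and a nested fixed point
-- expresses a simulation in the converse direction.
module Submission where

open import Defs
open import Level using (_⊔_) renaming (zero to lzero; suc to lsuc)
open import Data.Empty using (⊥-elim)
open import Data.Nat using (ℕ; _+_)
open import Data.Nat.Properties using (suc-injective)
open import Data.Fin using (Fin; _≟_)
open import Data.List using (List; []; _∷_; _++_; length; zipWith)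
open import Data.List.Properties using (length-++)
open import Data.List.Membership.Propositional using (find; lose)
open import Data.List.Relation.Unary.Any using (Any; any?)
open import Data.List.Relation.Unary.All using () renaming (lookup to All-lookup)
open import Data.Maybe using (just)
open import Data.Maybe.Properties using (just-injective)
open import Data.Product using (Σ; _×_; _,_; proj₁; proj₂; swap)
open import Data.Sum using (_⊎_; inj₁; inj₂) renaming (swap to ⊎-swap)
open import Data.Unit using (⊤; tt)
open import Relation.Nullary using (¬_; Dec; no)
open import Relation.Nullary.Decidable using (decidable-stable; map′; _×-dec_)
open import Relation.Binary.PropositionalEquality
  using (_≡_; refl; trans; cong; cong₂; subst; module ≡-Reasoning) renaming (sym to ≡-sym)

iff-sym : ∀ {a b} {A : Set a} {B : Set b} → A iff B → B iff A
iff-sym = swap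

iff-trans : ∀ {a b c} {A : Set a} {B : Set b} {C : Set c} → A iff B → B iff C → A iff C
iff-trans (f , g) (h , k) = (λ x → h (f x)) , (λ z → g (k z))

×-iff : ∀ {a b c d} {A : Set a} {B : Set b} {C : Set c} {D : Set d} →
        A iff B → C iff D → (A × C) iff (B × D)
×-iff (f , g) (h , k) = (λ (x , z) → f x , h z) , (λ (y , w) → g y , k w)

iff-cong : ∀ {a b c d} {A : Set a} {B : Set b} {C : Set c} {D : Set d} →
           A iff B → C iff D → (A iff C) iff (B iff D)
iff-cong A⇔B C⇔D = (λ A⇔C → iff-trans (iff-sym A⇔B) (iff-trans A⇔C C⇔D))
                 , (λ B⇔D → iff-trans A⇔B (iff-trans B⇔D (iff-sym C⇔D)))

Σ-iff : ∀ {i a b} {I : Set i} {A : I → Set a} {B : I → Set b} →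
        (∀ x → A x iff B x) → Σ I A iff Σ I B
Σ-iff A⇔B = (λ (x , y) → x , proj₁ (A⇔B x) y) , (λ (x , y) → x , proj₂ (A⇔B x) y)

Π-iff : ∀ {i a b} {I : Set i} {A : I → Set a} {B : I → Set b} →
        (∀ x → A x iff B x) → (∀ x → A x) iff (∀ x → B x)
Π-iff A⇔B = (λ f x → proj₁ (A⇔B x) (f x)) , (λ g x → proj₂ (A⇔B x) (g x))

module SimulationProperties (Lts : LTS) where
  open LTS Lts
  open LTSNotions Lts hiding (tt)

  Transfer : ∀ {κ} → (St → St → Set κ) → St → St → Set κ
  Transfer P s t = ∀ a s' → s ⟶⟨ a ⟩ s' → Σ St λ t' → (t ⟶⟨ a ⟩ t') × P s' t'

  SimWithin : ∀ {κ} → (St → St → Set κ) → St → St → Set (lsuc lzero ⊔ κ)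
  SimWithin C s t = Σ Rel λ ℛ → (IsSim ℛ × (∀ x y → ℛ x y → C x y)) × ℛ s t

  Enabled : St → Set
  Enabled s = Σ Ac λ a → a ∈I s

  AgreeOnDeadlock : St → St → Set
  AgreeOnDeadlock s t = (I-empty s → I-empty t) × (I-empty t → I-empty s)

  AgreeOnInitials : St → St → Set
  AgreeOnInitials s t = ∀ a → (a ∈I s → a ∈I t) × (a ∈I t → a ∈I s)

  ⊑s⇔simWithin-⊤ : ∀ {s t} → s ⊑s t iff SimWithin (λ _ _ → ⊤) s t
  ⊑s⇔simWithin-⊤ = (λ (ℛ , sim , r) → ℛ , (sim , λ _ _ _ → tt) , r)
                  , (λ (ℛ , (sim , _) , r) → ℛ , sim , r)

  ⊑2s⇔simWithin-⊒s : ∀ {s t} → s ⊑2s t iff SimWithin (λ x y → y ⊑s x) s t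
  ⊑2s⇔simWithin-⊒s {s} {t} = to , from
    where
    to : s ⊑2s t → SimWithin (λ x y → y ⊑s x) s t
    to (ℛ , (sim , ℛ' , sim' , ℛ⁻¹⊆ℛ') , r) = ℛ , (sim , λ x y rxy → ℛ' , sim' , ℛ⁻¹⊆ℛ' y x rxy) , r

    from : SimWithin (λ x y → y ⊑s x) s t → s ⊑2s t
    from (ℛ , (sim , within) , r) = ℛ , (sim , Witnesses , simW , ℛ⁻¹⊆W) , r
      where
      -- Gluing the witnesses of y ⊑s x for all pairs of ℛ keeps the relation small.
      Witnesses : Rel
      Witnesses x y = Σ St λ s₀ → Σ St λ t₀ → Σ (ℛ s₀ t₀) λ r₀ → proj₁ (within s₀ t₀ r₀) x y

      simW : IsSim Witnesses
      simW x y (s₀ , t₀ , r₀ , w) a x' xx' =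
        let (y' , yy' , w') = proj₁ (proj₂ (within s₀ t₀ r₀)) x y w a x' xx'
        in y' , yy' , (s₀ , t₀ , r₀ , w')

      ℛ⁻¹⊆W : ∀ x y → ℛ y x → Witnesses x y
      ℛ⁻¹⊆W x y ryx = y , x , ryx , proj₂ (proj₂ (within y x ryx))

  enabled-transfer : ∀ {s t} → Dec (Enabled t) → (I-empty t → I-empty s) → Enabled s → Enabled t
  enabled-transfer t? empty (a , s') =
    decidable-stable t? (λ ¬en → empty (λ b t' → ¬en (b , t')) a s')

  empty-transfer : ∀ {s t} → (Enabled t → Enabled s) → I-empty s → I-empty t
  empty-transfer en empty a t' = let (b , s') = en (a , t') in empty b s'

  agreeOnDeadlock⇔ : ∀ {s t} → Dec (Enabled s) → Dec (Enabled t) →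
                     AgreeOnDeadlock s t iff (Enabled s iff Enabled t)
  agreeOnDeadlock⇔ s? t? = (λ (f , g) → enabled-transfer t? g , enabled-transfer s? f)
                         , (λ (f , g) → empty-transfer g , empty-transfer f)

module ModalProperties (Lts : LTS) where
  open LTS Lts
  open LTSNotions Lts hiding (tt)

  ν-mono : ∀ {ℓ ℓ'} {F : Pred lzero → Pred ℓ} {G : Pred lzero → Pred ℓ'} →
           (∀ Z u → F Z u → G Z u) → ∀ {u} → ν F u → ν G u
  ν-mono F⊆G (S , post , s) = S , (λ x sx → F⊆G S x (post x sx)) , s

  [⊎]⇔ : ∀ {ℓ} {A B : Ac → Set} {φ : Pred ℓ} {u} →
         ([ (λ b → A b ⊎ B b) ] φ) u iff (([ A ] φ) u × ([ B ] φ) u)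
  [⊎]⇔ = (λ box → (λ b v x → box b v (inj₁ x)) , (λ b v y → box b v (inj₂ y)))
       , (λ (boxA , boxB) → λ { b v (inj₁ x) → boxA b v x ; b v (inj₂ y) → boxB b v y })

  ⟨⋃⟩⇔ : ∀ {ℓ} {I : Set} {A : I → Ac → Set} {φ : Pred ℓ} {u} →
         (⟨ (λ b → Σ I λ i → A i b) ⟩ φ) u iff Σ I λ i → (⟨ A i ⟩ φ) u
  ⟨⋃⟩⇔ = (λ (b , (i , x) , rest) → i , b , x , rest) , (λ (i , b , x , rest) → b , (i , x) , rest)

module Correspondence {nQ nΓ nA : ℕ} (kind : Fin nA → Kind) (Δ : PDA nQ nΓ nA)
                      (vpda : IsVPDA kind Δ) where
  open LTSNotions (LTSof Δ) using (Rel; IsSim; _∈I_; _⊑s_; _⊑cs_; _⊑rs_; _⊑2s_; _∼_)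
  open SimulationProperties (LTSof Δ)
  module F = Formulae Δ
  open F using (Pred; ν; [_]_; ⟨_⟩_; _∧_; ℓs; rs; ℓr; Acts; Bars; single)
  open ModalProperties (LTS' Δ)
  open PDALTS using (step)

  Γ : Set
  Γ = Fin nΓ

  St : Set
  St = Fin nQ × List Γ

  St' : Set
  St' = (Fin nQ × Fin nQ) × List (G nΓ nA × G nΓ nA)

  Step : St → Fin nA → St → Set
  Step = PDALTS.Step (RuleOf Δ)

  Step' : St' → Act' nA → St' → Set
  Step' = PDALTS.Step (Rule' Δ)

  private variable
    k : Kind
    p q p₀ q₀ : Fin nQ
    X Y : Γ
    a : Fin nA
    b : Act' nA
    α β α₀ β₀ : List Γ
    g : G nΓ nA
    m : List (G nΓ nA × G nΓ nA)
    s t s' t' : St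
    u v : St'

  same-label-same-length : ∀ {p X q α p' X' q' α'} → RuleOf Δ p X a q α → RuleOf Δ p' X' a q' α' →
                           length α ≡ length α'
  same-label-same-length ρ ρ' = trans (All-lookup vpda ρ) (≡-sym (All-lookup vpda ρ'))

  SameHeight : St → St → Set
  SameHeight (_ , α) (_ , β) = length α ≡ length β

  same-label-preserves-height : SameHeight s t → Step s a s' → Step t a t' → SameHeight s' t'
  same-label-preserves-height {s = _ , _ ∷ α} {t = _ , _ ∷ β} h (step {α = α₀} ρ) (step {α = β₀} ρ') =
    begin
      length (α₀ ++ α)        ≡⟨ length-++ α₀ ⟩
      length α₀ + length α    ≡⟨ cong₂ _+_ (same-label-same-length ρ ρ') (suc-injective h) ⟩
      length β₀ + length β    ≡⟨ length-++ β₀ ⟨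
      length (β₀ ++ β)        ∎
    where open ≡-Reasoning

  _⊗ₛ_ : List Γ → List Γ → List (G nΓ nA × G nΓ nA)
  _⊗ₛ_ = zipWith (λ X Y → sym X , sym Y)

  _⊗_ : St → St → St'
  (p , α) ⊗ (q , β) = (p , q) , α ⊗ₛ β

  ⊗ₛ-++ : ∀ α₀ α₁ {α β} → length α₀ ≡ length α₁ → (α₀ ++ α) ⊗ₛ (α₁ ++ β) ≡ α₀ ⊗ₛ α₁ ++ α ⊗ₛ β
  ⊗ₛ-++ []       []       _ = refl
  ⊗ₛ-++ (X ∷ α₀) (Y ∷ α₁) h = cong ((sym X , sym Y) ∷_) (⊗ₛ-++ α₀ α₁ (suc-injective h))

  merge-same-length : ∀ α β → length α ≡ length β → merge α β ≡ just (α ⊗ₛ β)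
  merge-same-length []      []      _ = refl
  merge-same-length (X ∷ α) (Y ∷ β) h rewrite merge-same-length α β (suc-injective h) = refl

  merge-++ : ∀ α₀ α₁ {α β} → length α₀ ≡ length α₁ → merge α₀ α₁ ≡ just m →
             m ++ α ⊗ₛ β ≡ (α₀ ++ α) ⊗ₛ (α₁ ++ β)
  merge-++ α₀ α₁ h e
    rewrite just-injective (trans (≡-sym e) (merge-same-length α₀ α₁ h)) = ≡-sym (⊗ₛ-++ α₀ α₁ h)

  wordG-defined : ∀ α → length α ≡ arity k → Σ (G nΓ nA) λ g → wordG α ≡ just g
  wordG-defined []                   _ = _ , refl
  wordG-defined (_ ∷ [])             _ = _ , refl
  wordG-defined (_ ∷ _ ∷ [])         _ = _ , refl
  wordG-defined {call} (_ ∷ _ ∷ _ ∷ _) ()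
  wordG-defined {ret}  (_ ∷ _ ∷ _ ∷ _) ()
  wordG-defined {int}  (_ ∷ _ ∷ _ ∷ _) ()

  unwordG : G nΓ nA → List Γ
  unwordG (sym X)    = X ∷ []
  unwordG (pair X Y) = X ∷ Y ∷ []
  unwordG (tag _ _)  = []
  unwordG eps        = []

  unwordG-wordG : wordG α ≡ just g → unwordG g ≡ α
  unwordG-wordG {[]}                 refl = refl
  unwordG-wordG {_ ∷ []}             refl = refl
  unwordG-wordG {_ ∷ _ ∷ []}         refl = refl
  unwordG-wordG {_ ∷ _ ∷ _ ∷ _}      ()

  wordG-injective : wordG α ≡ just g → wordG β ≡ just g → α ≡ β
  wordG-injective e e' = trans (≡-sym (unwordG-wordG e)) (unwordG-wordG e')

  wordG-not-tag : ¬ wordG α ≡ just (tag X a)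
  wordG-not-tag {[]}            ()
  wordG-not-tag {_ ∷ []}        ()
  wordG-not-tag {_ ∷ _ ∷ []}    ()
  wordG-not-tag {_ ∷ _ ∷ _ ∷ _} ()

  data Side : Set where
    left right : Side

  opposite : Side → Side
  opposite left  = right
  opposite right = left

  challenge answer : Side → Act' nA
  challenge left  = L
  challenge right = R
  answer    left  = R
  answer    right = L

  -- The first argument is the challenger, whichever component of Δ' it occupies.
  at : Side → St → St → St'
  at left  c d = c ⊗ d
  at right c d = d ⊗ c

  Box : Side → ∀ {ℓ} → Pred ℓ → Pred ℓ
  Box side Z = [ (_≡ challenge side) ] (⟨ (_≡ answer side) ⟩ Z)

  -- u is reached once the challenger has moved to c' by a; only the defender d may continue, by a.
  record Pending (side : Side) (a : Fin nA) (c' d : St) (u : St') : Set where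
    field
      only-answers : Step' u b v → b ≡ answer side × Σ St λ d' → Step d a d' × v ≡ at side c' d'
      all-answers  : ∀ {d'} → Step d a d' → Step' u (answer side) (at side c' d')

  left-only-answers : RuleOf Δ p X a p₀ α₀ → wordG α₀ ≡ just g →
    Step' ((p₀ , q) , (g , tag Y a) ∷ α ⊗ₛ β) b v →
    b ≡ R × Σ St λ t' → Step (q , Y ∷ β) a t' × v ≡ (p₀ , α₀ ++ α) ⊗ t'
  left-only-answers ρ eq (step (r3 _ _ ρ' eq' e)) with wordG-injective eq' eq
  ... | refl = refl , _ , step ρ' , cong (_ ,_) (merge-++ _ _ (same-label-same-length ρ ρ') e)
  left-only-answers ρ eq (step (r4 _ _ _ _ _)) = ⊥-elim (wordG-not-tag eq)

  left-all-answers : RuleOf Δ p X a p₀ α₀ → wordG α₀ ≡ just g → Step (q , Y ∷ β) a t' →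
    Step' ((p₀ , q) , (g , tag Y a) ∷ α ⊗ₛ β) R ((p₀ , α₀ ++ α) ⊗ t')
  left-all-answers {p₀ = p₀} {α₀ = α₀} {q = q} {Y = Y} {β = β} {α = α} ρ eq (step {q = q₁} {α = α₁} ρ') =
    subst (λ w → Step' ((p₀ , q) , (_ , tag Y _) ∷ α ⊗ₛ β) R ((p₀ , q₁) , w))
          (merge-++ α₀ α₁ h (merge-same-length α₀ α₁ h))
          (step (r3 _ α₀ ρ' eq (merge-same-length α₀ α₁ h)))
    where h = same-label-same-length ρ ρ'

  right-only-answers : RuleOf Δ q Y a q₀ β₀ → wordG β₀ ≡ just g →
    Step' ((p , q₀) , (tag X a , g) ∷ α ⊗ₛ β) b v →
    b ≡ L × Σ St λ s' → Step (p , X ∷ α) a s' × v ≡ s' ⊗ (q₀ , β₀ ++ β)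
  right-only-answers ρ eq (step (r4 _ _ ρ' eq' e)) with wordG-injective eq' eq
  ... | refl = refl , _ , step ρ' , cong (_ ,_) (merge-++ _ _ (same-label-same-length ρ' ρ) e)
  right-only-answers ρ eq (step (r3 _ _ _ _ _)) = ⊥-elim (wordG-not-tag eq)

  right-all-answers : RuleOf Δ q Y a q₀ β₀ → wordG β₀ ≡ just g → Step (p , X ∷ α) a s' →
    Step' ((p , q₀) , (tag X a , g) ∷ α ⊗ₛ β) L (s' ⊗ (q₀ , β₀ ++ β))
  right-all-answers {q₀ = q₀} {β₀ = β₀} {p = p} {X = X} {α = α} {β = β} ρ eq (step {q = p₁} {α = α₁} ρ') =
    subst (λ w → Step' ((p , q₀) , (tag X _ , _) ∷ α ⊗ₛ β) L ((p₁ , q₀) , w))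
          (merge-++ α₁ β₀ h (merge-same-length α₁ β₀ h))
          (step (r4 _ β₀ ρ' eq (merge-same-length α₁ β₀ h)))
    where h = same-label-same-length ρ' ρ

  left-pending : RuleOf Δ p X a p₀ α₀ → wordG α₀ ≡ just g →
                 Pending left a (p₀ , α₀ ++ α) (q , Y ∷ β) ((p₀ , q) , (g , tag Y a) ∷ α ⊗ₛ β)
  left-pending ρ eq = record { only-answers = left-only-answers ρ eq ; all-answers = left-all-answers ρ eq }

  right-pending : RuleOf Δ q Y a q₀ β₀ → wordG β₀ ≡ just g →
                  Pending right a (q₀ , β₀ ++ β) (p , X ∷ α) ((p , q₀) , (tag X a , g) ∷ α ⊗ₛ β)
  right-pending ρ eq = record { only-answers = right-only-answers ρ eq ; all-answers = right-all-answers ρ eq }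

  challenges : ∀ side {c d} → Step' (at side c d) (challenge side) u →
               Σ (Fin nA) λ a → Σ St λ c' → Step c a c' × Pending side a c' d u
  challenges left {_ , []} ()
  challenges left {_ , _ ∷ _} {_ , []} ()
  challenges left {_ , _ ∷ _} {_ , _ ∷ _} (step (r1 _ _ ρ eq)) =
    _ , _ , step ρ , left-pending ρ eq
  challenges right {_ , []} {_ , []} ()
  challenges right {_ , []} {_ , _ ∷ _} ()
  challenges right {_ , _ ∷ _} {_ , []} ()
  challenges right {_ , _ ∷ _} {_ , _ ∷ _} (step (r2 _ _ ρ eq)) =
    _ , _ , step ρ , right-pending ρ eq

  challenge-exists : ∀ side {c d c'} → SameHeight c d → Step c a c' →
                     Σ St' λ u → Step' (at side c d) (challenge side) u × Pending side a c' d u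
  challenge-exists left {d = _ , []} () (step _)
  challenge-exists left {d = _ , _ ∷ _} _ (step {α = α₀} ρ) with wordG-defined α₀ (All-lookup vpda ρ)
  ... | _ , eq = _ , step (r1 _ _ ρ eq) , left-pending ρ eq
  challenge-exists right {d = _ , []} () (step _)
  challenge-exists right {d = _ , _ ∷ _} _ (step {α = β₀} ρ) with wordG-defined β₀ (All-lookup vpda ρ)
  ... | _ , eq = _ , step (r2 _ _ ρ eq) , right-pending ρ eq

  box⇔transfer : ∀ side {ℓ} {Z : Pred ℓ} {A : Act' nA → Set} {c d} → A (answer side) → SameHeight c d →
    ([ (_≡ challenge side) ] (⟨ A ⟩ Z)) (at side c d) iff Transfer (λ c' d' → Z (at side c' d')) c d
  box⇔transfer side {Z = Z} {A} {c} {d} answer∈A h = box⇒transfer , transfer⇒box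
    where
    box⇒transfer : ([ (_≡ challenge side) ] (⟨ A ⟩ Z)) (at side c d) →
                   Transfer (λ c' d' → Z (at side c' d')) c d
    box⇒transfer box a c' cc' with challenge-exists side h cc'
    ... | u , move , pending with box _ u refl move
    ... | _ , _ , _ , reply , z with Pending.only-answers pending reply
    ... | _ , d' , dd' , refl = d' , dd' , z

    transfer⇒box : Transfer (λ c' d' → Z (at side c' d')) c d →
                   ([ (_≡ challenge side) ] (⟨ A ⟩ Z)) (at side c d)
    transfer⇒box transfer _ u refl move with challenges side move
    ... | a , c' , cc' , pending with transfer a c' cc'
    ... | d' , dd' , z = answer side , answer∈A , at side c' d' , Pending.all-answers pending dd' , z

  simWithin⇔ν : ∀ side {κ ℓ} {C : St → St → Set κ} {D : Pred ℓ} →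
                (∀ {x y} → SameHeight x y → C x y iff D (at side x y)) →
                ∀ {s t} → SameHeight s t → SimWithin C s t iff ν (λ Z → Box side Z ∧ D) (at side s t)
  simWithin⇔ν side {C = C} {D} C⇔D {s} {t} h = to , from
    where
    to : SimWithin C s t → ν (λ Z → Box side Z ∧ D) (at side s t)
    to (ℛ , (sim , ℛ⊆C) , r) = Image , post , (s , t , h , r , refl)
      where
      Image : Pred lzero
      Image u = Σ St λ x → Σ St λ y → SameHeight x y × ℛ x y × u ≡ at side x y

      post : ∀ u → Image u → (Box side Image ∧ D) u
      post _ (x , y , hxy , rxy , refl) =
          proj₂ (box⇔transfer side refl hxy)
            (λ a x' xx' → let (y' , yy' , r') = sim x y rxy a x' xx'
                          in y' , yy' , (x' , y' , same-label-preserves-height hxy xx' yy' , r' , refl))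
        , proj₁ (C⇔D hxy) (ℛ⊆C x y rxy)

    from : ν (λ Z → Box side Z ∧ D) (at side s t) → SimWithin C s t
    from (Z , post , z) = Related , (sim , Related⊆C) , (h , z)
      where
      Related : Rel
      Related x y = SameHeight x y × Z (at side x y)

      sim : IsSim Related
      sim x y (hxy , zxy) a x' xx' =
        let (y' , yy' , z') = proj₁ (box⇔transfer side refl hxy) (proj₁ (post _ zxy)) a x' xx'
        in y' , yy' , (same-label-preserves-height hxy xx' yy' , z')

      Related⊆C : ∀ x y → Related x y → C x y
      Related⊆C x y (hxy , zxy) = proj₂ (C⇔D hxy) (proj₂ (post _ zxy))

  ⊑s⇔ν : ∀ side {s t} → SameHeight s t → s ⊑s t iff ν (Box side) (at side s t)
  ⊑s⇔ν side h =
    iff-trans ⊑s⇔simWithin-⊤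
      (iff-trans (simWithin⇔ν side {D = F.tt} (λ _ → (λ _ → tt) , (λ _ → tt)) h)
                 (ν-mono (λ _ _ → proj₁) , ν-mono (λ _ _ box → box , tt)))

  nested-at : ∀ side {x y} → SameHeight x y → (y ⊑s x) iff ν (Box (opposite side)) (at side x y)
  nested-at left  h = ⊑s⇔ν right (≡-sym h)
  nested-at right h = ⊑s⇔ν left (≡-sym h)

  ⊑2s⇔ν : ∀ side {s t} → SameHeight s t →
          s ⊑2s t iff ν (λ Z → Box side Z ∧ ν (Box (opposite side))) (at side s t)
  ⊑2s⇔ν side h = iff-trans ⊑2s⇔simWithin-⊒s (simWithin⇔ν side (nested-at side) h)

  enabled? : ∀ s → Dec (Enabled s)
  enabled? (_ , []) = no λ { (_ , _ , ()) }
  enabled? (q , Y ∷ β) =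
    map′ enabled-by-rule rule-of-move (any? (λ ρ → (Rule.src ρ ≟ q) ×-dec (Rule.top ρ ≟ Y)) Δ)
    where
    enabled-by-rule : Any (λ ρ → Rule.src ρ ≡ q × Rule.top ρ ≡ Y) Δ → Enabled (q , Y ∷ β)
    enabled-by-rule any with find any
    ... | rule _ _ a _ _ , ρ , refl , refl = a , _ , step ρ

    rule-of-move : Enabled (q , Y ∷ β) → Any (λ ρ → Rule.src ρ ≡ q × Rule.top ρ ≡ Y) Δ
    rule-of-move (_ , _ , step ρ) = lose ρ (refl , refl)

  act-enabled : SameHeight s t → (⟨ single (act a) ⟩ F.tt) (s ⊗ t) iff a ∈I s
  act-enabled {s = _ , []} _ = (λ { (_ , _ , _ , () , _) }) , (λ { (_ , ()) })
  act-enabled {s = _ , _ ∷ _} {t = _ , []} ()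
  act-enabled {s = _ , _ ∷ _} {t = _ , _ ∷ _} _ =
      (λ { (_ , refl , _ , step (r5 _ _ ρ) , _) → _ , step ρ })
    , (λ { (_ , step ρ) → _ , refl , _ , step (r5 _ _ ρ) , tt })

  bar-enabled : SameHeight s t → (⟨ single (bar a) ⟩ F.tt) (s ⊗ t) iff a ∈I t
  bar-enabled {s = _ , []}    {t = _ , []}    _  = (λ { (_ , _ , _ , () , _) }) , (λ { (_ , ()) })
  bar-enabled {s = _ , []}    {t = _ , _ ∷ _} ()
  bar-enabled {s = _ , _ ∷ _} {t = _ , []}    ()
  bar-enabled {s = _ , _ ∷ _} {t = _ , _ ∷ _} _ =
      (λ { (_ , refl , _ , step (r6 _ _ ρ) , _) → _ , step ρ })
    , (λ { (_ , step ρ) → _ , refl , _ , step (r6 _ _ ρ) , tt })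

  DeadlockFormula : Pred lzero
  DeadlockFormula = (⟨ Acts ⟩ F.tt) F.⇔ (⟨ Bars ⟩ F.tt)

  InitialsFormula : Pred lzero
  InitialsFormula u = ∀ a → ((⟨ single (act a) ⟩ F.tt) F.⇔ (⟨ single (bar a) ⟩ F.tt)) u

  agreeOnDeadlock⇔formula : SameHeight s t → AgreeOnDeadlock s t iff DeadlockFormula (s ⊗ t)
  agreeOnDeadlock⇔formula {s} {t} h =
    iff-trans (agreeOnDeadlock⇔ (enabled? s) (enabled? t))
              (iff-sym (iff-cong (iff-trans ⟨⋃⟩⇔ (Σ-iff λ _ → act-enabled h))
                                 (iff-trans ⟨⋃⟩⇔ (Σ-iff λ _ → bar-enabled h))))

  agreeOnInitials⇔formula : SameHeight s t → AgreeOnInitials s t iff InitialsFormula (s ⊗ t)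
  agreeOnInitials⇔formula h = iff-sym (Π-iff λ _ → iff-cong (act-enabled h) (bar-enabled h))

  deadlock-at : ∀ side {x y} → SameHeight x y → AgreeOnDeadlock x y iff DeadlockFormula (at side x y)
  deadlock-at left  h = agreeOnDeadlock⇔formula h
  deadlock-at right h = iff-trans (swap , swap) (agreeOnDeadlock⇔formula (≡-sym h))

  initials-at : ∀ side {x y} → SameHeight x y → AgreeOnInitials x y iff InitialsFormula (at side x y)
  initials-at left  h = agreeOnInitials⇔formula h
  initials-at right h = iff-trans ((λ i a → swap (i a)) , (λ i a → swap (i a)))
                                  (agreeOnInitials⇔formula (≡-sym h))

  ⊑cs⇔ν : ∀ side {s t} → SameHeight s t →
          s ⊑cs t iff ν (λ Z → Box side Z ∧ DeadlockFormula) (at side s t)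
  ⊑cs⇔ν side = simWithin⇔ν side (deadlock-at side)

  ⊑rs⇔ν : ∀ side {s t} → SameHeight s t →
          s ⊑rs t iff ν (λ Z → Box side Z ∧ InitialsFormula) (at side s t)
  ⊑rs⇔ν side = simWithin⇔ν side (initials-at side)

  ∼⇔φ∼ : SameHeight s t → s ∼ t iff F.φ∼ (s ⊗ t)
  ∼⇔φ∼ {s} {t} h = to , from
    where
    to : s ∼ t → F.φ∼ (s ⊗ t)
    to (ℛ , (sim , _ , ℛ⊆ℛ⁻¹) , r) = Image , post , (s , t , h , r , refl)
      where
      Image : Pred lzero
      Image u = Σ St λ x → Σ St λ y → SameHeight x y × ℛ x y × u ≡ x ⊗ y

      post : ∀ u → Image u → ([ ℓr ] (⟨ ℓr ⟩ Image)) u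
      post _ (x , y , hxy , rxy , refl) = proj₂ [⊎]⇔
        ( proj₂ (box⇔transfer left (inj₂ refl) hxy)
            (λ a x' xx' → let (y' , yy' , r') = sim x y rxy a x' xx'
                          in y' , yy' , (x' , y' , same-label-preserves-height hxy xx' yy' , r' , refl))
        , proj₂ (box⇔transfer right (inj₁ refl) (≡-sym hxy))
            (λ a y' yy' → let (x' , xx' , r') = sim y x (ℛ⊆ℛ⁻¹ x y rxy) a y' yy'
                          in x' , xx' , (x' , y' , same-label-preserves-height hxy xx' yy'
                                        , ℛ⊆ℛ⁻¹ y' x' r' , refl)))

    from : F.φ∼ (s ⊗ t) → s ∼ t
    from (Z , post , z) = Related , (sim , (λ _ _ → ⊎-swap) , (λ _ _ → ⊎-swap)) , inj₁ (h , z)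
      where
      Related : Rel
      Related x y = (SameHeight x y × Z (x ⊗ y)) ⊎ (SameHeight y x × Z (y ⊗ x))

      boxes : ∀ u → Z u → ([ ℓs ] (⟨ ℓr ⟩ Z)) u × ([ rs ] (⟨ ℓr ⟩ Z)) u
      boxes u zu = proj₁ [⊎]⇔ (post u zu)

      sim : IsSim Related
      sim x y (inj₁ (hxy , zxy)) a x' xx' =
        let (y' , yy' , z') = proj₁ (box⇔transfer left (inj₂ refl) hxy) (proj₁ (boxes _ zxy)) a x' xx'
        in y' , yy' , inj₁ (same-label-preserves-height hxy xx' yy' , z')
      sim x y (inj₂ (hyx , zyx)) a x' xx' =
        let (y' , yy' , z') = proj₁ (box⇔transfer right (inj₁ refl) (≡-sym hyx)) (proj₂ (boxes _ zyx)) a x' xx'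
        in y' , yy' , inj₂ (same-label-preserves-height hyx yy' xx' , z')

lemma3p2 : ∀ {nQ nΓ nA : ℕ} (kind : Fin nA → Kind) (Δ : PDA nQ nΓ nA) →
    IsVPDA kind Δ →
    (p q : Fin nQ) (X Y : Fin nΓ) →
      (LTSNotions._⊑s_ (LTSof Δ) (proc p X) (proc q Y) iff Formulae.φ⊑s Δ (conf' p q X Y))
    × (LTSNotions._=s_ (LTSof Δ) (proc p X) (proc q Y) iff Formulae.φ=s Δ (conf' p q X Y))
    × (LTSNotions._⊑cs_ (LTSof Δ) (proc p X) (proc q Y) iff Formulae.φ⊑cs Δ (conf' p q X Y))
    × (LTSNotions._=cs_ (LTSof Δ) (proc p X) (proc q Y) iff Formulae.φ=cs Δ (conf' p q X Y))
    × (LTSNotions._⊑rs_ (LTSof Δ) (proc p X) (proc q Y) iff Formulae.φ⊑rs Δ (conf' p q X Y))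
    × (LTSNotions._=rs_ (LTSof Δ) (proc p X) (proc q Y) iff Formulae.φ=rs Δ (conf' p q X Y))
    × (LTSNotions._⊑2s_ (LTSof Δ) (proc p X) (proc q Y) iff Formulae.φ⊑2s Δ (conf' p q X Y))
    × (LTSNotions._=2s_ (LTSof Δ) (proc p X) (proc q Y) iff Formulae.φ=2s Δ (conf' p q X Y))
    × (LTSNotions._∼_ (LTSof Δ) (proc p X) (proc q Y) iff Formulae.φ∼ Δ (conf' p q X Y))
lemma3p2 kind Δ vpda p q X Y =
    ⊑s⇔ν left refl
  , ×-iff (⊑s⇔ν left refl) (⊑s⇔ν right refl)
  , ⊑cs⇔ν left refl
  , ×-iff (⊑cs⇔ν left refl) (⊑cs⇔ν right refl)
  , ⊑rs⇔ν left refl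
  , ×-iff (⊑rs⇔ν left refl) (⊑rs⇔ν right refl)
  , ⊑2s⇔ν left refl
  , ×-iff (⊑2s⇔ν left refl) (⊑2s⇔ν right refl)
  , ∼⇔φ∼ refl
  where open Correspondence kind Δ vpda
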